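{- Let $n>1$ and let $\pi$ be a permutation of $[n]$. In the left bracketing of $\pi$, every meld of the form $(m_1,m_2)$ that is formed has $m_2$ either a singleton or of the form $[m_{21},m_{22}]$, and every meld of the form $[m_1,m_2]$ that is formed has $m_2$ either a singleton or of the form $(m_{21},m_{22})$. Symmetrically, in the right bracketing of $\pi$, every meld $(m_1,m_2)$ formed has $m_1$ a singleton or of the form $[m_{11},m_{12}]$, and every meld $[m_1,m_2]$ formed has $m_1$ a singleton or of the form $(m_{11},m_{12})$.
   Context: $[n]=\{1,\dots,n\}$; $\pi=a_1\cdots a_n$ in one-line notation. Melds: each entry $a_j$ (at position $j$) is a meld with entry set $\{a_j\}$. If $m_1,m_2$ are melds occupying adjacent intervals of positions, $m_1$ immediately left of $m_2$, with entry sets $E_1,E_2$ such that $E_1\cup E_2$ is a set of consecutive integers, they are mergeable; their merger is $(m_1,m_2)$ if $\max E_1+1=\min E_2$ and $[m_1,m_2]$ if $\min E_1=\max E_2+1$, with entry set $E_1\cup E_2$. Left bracketing: start with the sequence of singleton melds $a_1,\dots,a_n$; repeatedly scan the current sequence of melds from left to right and replace the leftmost adjacent mergeable pair by its merger; stop when no adjacent pair is mergeable. Right bracketing is the same except that the rightmost adjacent mergeable pair is merged at each step. -}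

module Defs where

open import Data.Nat using (ℕ; zero; suc; _+_; _⊓_; _⊔_; _≟_)
open import Data.Fin using (Fin; toℕ)
open import Data.Fin.Permutation using (Permutation′; _⟨$⟩ʳ_)
open import Data.List using (List; []; _∷_; map; length; allFin)
open import Data.Maybe using (Maybe; just; nothing)
open import Data.Product using (_×_; _,_)
open import Data.Sum using (_⊎_)
open import Data.Unit using (⊤)
open import Data.Empty using (⊥)
open import Relation.Nullary using (yes; no)

-- A meld, as a bracketed word:
--   leaf a    : the singleton meld with entry a
--   inc m₁ m₂ : the merger (m₁,m₂)   (max E₁ + 1 = min E₂)
--   dec m₁ m₂ : the merger [m₁,m₂]   (min E₁ = max E₂ + 1)
data Meld : Set where
  leaf : ℕ → Meld
  inc  : Meld → Meld → Meld
  dec  : Meld → Meld → Meld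

lo : Meld → ℕ
lo (leaf a)    = a
lo (inc m₁ m₂) = lo m₁ ⊓ lo m₂
lo (dec m₁ m₂) = lo m₁ ⊓ lo m₂

hi : Meld → ℕ
hi (leaf a)    = a
hi (inc m₁ m₂) = hi m₁ ⊔ hi m₂
hi (dec m₁ m₂) = hi m₁ ⊔ hi m₂

-- Entry sets of melds are disjoint sets of consecutive integers, so their union
-- is consecutive iff max E₁ + 1 = min E₂ or min E₁ = max E₂ + 1.
merge : Meld → Meld → Maybe Meld
merge m₁ m₂ with suc (hi m₁) ≟ lo m₂
... | yes _ = just (inc m₁ m₂)
... | no _ with lo m₁ ≟ suc (hi m₂)
...   | yes _ = just (dec m₁ m₂)
...   | no _  = nothing

stepL : List Meld → Maybe (List Meld × Meld)
stepL []             = nothing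
stepL (x ∷ [])       = nothing
stepL (x ∷ y ∷ rest) = pick (merge x y) (stepL (y ∷ rest))
  where
  pick : Maybe Meld → Maybe (List Meld × Meld) → Maybe (List Meld × Meld)
  pick (just m) _              = just (m ∷ rest , m)
  pick nothing (just (l , m))  = just (x ∷ l , m)
  pick nothing nothing         = nothing

stepR : List Meld → Maybe (List Meld × Meld)
stepR []             = nothing
stepR (x ∷ [])       = nothing
stepR (x ∷ y ∷ rest) = pick (stepR (y ∷ rest)) (merge x y)
  where
  pick : Maybe (List Meld × Meld) → Maybe Meld → Maybe (List Meld × Meld)
  pick (just (l , m)) _ = just (x ∷ l , m)
  pick nothing (just m) = just (m ∷ rest , m)
  pick nothing nothing  = nothing

formed : (List Meld → Maybe (List Meld × Meld)) → ℕ → List Meld → List Meld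
formed step zero    l = []
formed step (suc k) l with step l
... | nothing       = []
... | just (l′ , m) = m ∷ formed step k l′

-- Each step reduces the length by one, so fuel = length suffices to run to completion.
formedLeft : List Meld → List Meld
formedLeft l = formed stepL (length l) l

formedRight : List Meld → List Meld
formedRight l = formed stepR (length l) l

-- One-line notation of a permutation of [n] (values shifted to 1..n),
-- as the initial sequence of singleton melds a₁,…,aₙ.
singletons : ∀ {n} → Permutation′ n → List Meld
singletons {n} π = map (λ j → leaf (suc (toℕ (π ⟨$⟩ʳ j)))) (allFin n)

IsSingleton : Meld → Set
IsSingleton (leaf _) = ⊤
IsSingleton _        = ⊥

IsInc : Meld → Set
IsInc (inc _ _) = ⊤
IsInc _         = ⊥

IsDec : Meld → Set
IsDec (dec _ _) = ⊤
IsDec _         = ⊥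

LeftOK : Meld → Set
LeftOK (leaf _)    = ⊤
LeftOK (inc m₁ m₂) = IsSingleton m₂ ⊎ IsDec m₂
LeftOK (dec m₁ m₂) = IsSingleton m₂ ⊎ IsInc m₂

RightOK : Meld → Set
RightOK (leaf _)    = ⊤
RightOK (inc m₁ m₂) = IsSingleton m₁ ⊎ IsDec m₁
RightOK (dec m₁ m₂) = IsSingleton m₁ ⊎ IsInc m₁

-- Left bracketing keeps its sequence of melds in one shape (LeftInv): neighbours that
-- cannot merge, then the meld h formed last, then singletons only. The left neighbour w
-- of h could not merge with h's left component x, or (w , x) would have been the leftmost
-- mergeable pair. In its own orientation h presents x's boundary to the left (lo for
-- (x , y), hi for [x , y]), so w cannot merge with h in h's orientation, and a later
-- merger of w and h has the other one, as LeftOK demands. Right bracketing is the mirror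
-- image: singletons, the meld formed last, then neighbours that cannot merge.
module Submission where

open import Defs
open import Data.Nat using (ℕ; suc; zero; _<_; _≤_; _≟_)
open import Data.Nat.Properties
  using (≤-refl; ≤-trans; ≤-reflexive; <⇒≤; ⊓-mono-≤; m⊓n≤m⊔n;
         m≤n⇒m⊓n≡m; m≥n⇒m⊓n≡n; m≤n⇒m⊔n≡n; m≥n⇒m⊔n≡m)
open import Data.Fin.Permutation using (Permutation′)
open import Data.List using (List; []; _∷_; length; allFin)
open import Data.List.Relation.Unary.All using (All; []; _∷_; universal)
open import Data.List.Relation.Unary.All.Properties using (map⁺)
open import Data.List.Relation.Unary.Linked using (Linked; []; [-]; _∷_)
open import Data.Maybe using (just; nothing)
open import Data.Product using (_×_; _,_; ∃-syntax; map₂)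
open import Data.Sum using (_⊎_; inj₁; inj₂)
open import Data.Unit using (tt)
open import Data.Empty using (⊥)
open import Relation.Nullary using (yes; no; ¬_; contradiction)
open import Relation.Binary.PropositionalEquality using (_≡_; refl; sym; trans; cong)

lo≤hi : ∀ m → lo m ≤ hi m
lo≤hi (leaf a)  = ≤-refl
lo≤hi (inc a b) = ≤-trans (⊓-mono-≤ (lo≤hi a) (lo≤hi b)) (m⊓n≤m⊔n (hi a) (hi b))
lo≤hi (dec a b) = ≤-trans (⊓-mono-≤ (lo≤hi a) (lo≤hi b)) (m⊓n≤m⊔n (hi a) (hi b))

IncMergeable DecMergeable : Meld → Meld → Set
IncMergeable x y = suc (hi x) ≡ lo y
DecMergeable x y = lo x ≡ suc (hi y)

record Unmergeable (x y : Meld) : Set where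
  constructor unmergeable
  field
    ¬inc : ¬ IncMergeable x y
    ¬dec : ¬ DecMergeable x y

data Merger (x y : Meld) : Meld → Set where
  inc : IncMergeable x y → Merger x y (inc x y)
  dec : DecMergeable x y → Merger x y (dec x y)

merge≡just⇒merger : ∀ x y {m} → merge x y ≡ just m → Merger x y m
merge≡just⇒merger x y eq with suc (hi x) ≟ lo y
merge≡just⇒merger x y refl | yes p = inc p
... | no _ with lo x ≟ suc (hi y)
merge≡just⇒merger x y refl | no _ | yes q = dec q

merge≡nothing⇒unmergeable : ∀ x y → merge x y ≡ nothing → Unmergeable x y
merge≡nothing⇒unmergeable x y eq with suc (hi x) ≟ lo y
merge≡nothing⇒unmergeable x y () | yes _
... | no ¬p with lo x ≟ suc (hi y)
merge≡nothing⇒unmergeable x y () | no _ | yes _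
... | no ¬q = unmergeable ¬p ¬q

unmergeable⇒merge≡nothing : ∀ {x y} → Unmergeable x y → merge x y ≡ nothing
unmergeable⇒merge≡nothing {x} {y} (unmergeable ¬p ¬q) with suc (hi x) ≟ lo y
... | yes p = contradiction p ¬p
... | no _ with lo x ≟ suc (hi y)
...   | yes q = contradiction q ¬q
...   | no _  = refl

merger⇒¬unmergeable : ∀ {x y m} → Merger x y m → ¬ Unmergeable x y
merger⇒¬unmergeable (inc p) (unmergeable ¬inc _) = ¬inc p
merger⇒¬unmergeable (dec q) (unmergeable _ ¬dec) = ¬dec q

lo-inc : ∀ x y → IncMergeable x y → lo (inc x y) ≡ lo x
lo-inc x y p = m≤n⇒m⊓n≡m (≤-trans (lo≤hi x) (<⇒≤ (≤-reflexive p)))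

hi-inc : ∀ x y → IncMergeable x y → hi (inc x y) ≡ hi y
hi-inc x y p = m≤n⇒m⊔n≡n (≤-trans (<⇒≤ (≤-reflexive p)) (lo≤hi y))

lo-dec : ∀ x y → DecMergeable x y → lo (dec x y) ≡ lo y
lo-dec x y q = m≥n⇒m⊓n≡n (≤-trans (lo≤hi y) (<⇒≤ (≤-reflexive (sym q))))

hi-dec : ∀ x y → DecMergeable x y → hi (dec x y) ≡ hi x
hi-dec x y q = m≥n⇒m⊔n≡m (≤-trans (<⇒≤ (≤-reflexive (sym q))) (lo≤hi x))

-- SameWayˡ x y : x merges with y in y's own orientation; such mergers are exactly the
-- ones LeftOK excludes. SameWayʳ is the mirror notion for RightOK.
SameWayˡ SameWayʳ : Meld → Meld → Set
SameWayˡ x (leaf _)    = ⊥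
SameWayˡ x y@(inc _ _) = IncMergeable x y
SameWayˡ x y@(dec _ _) = DecMergeable x y
SameWayʳ (leaf _)    y = ⊥
SameWayʳ x@(inc _ _) y = IncMergeable x y
SameWayʳ x@(dec _ _) y = DecMergeable x y

merger-LeftOK : ∀ {x y m} → Merger x y m → ¬ SameWayˡ x y → LeftOK m
merger-LeftOK {y = leaf _}  (inc _) _     = inj₁ tt
merger-LeftOK {y = inc _ _} (inc p) ¬same = contradiction p ¬same
merger-LeftOK {y = dec _ _} (inc _) _     = inj₂ tt
merger-LeftOK {y = leaf _}  (dec _) _     = inj₁ tt
merger-LeftOK {y = inc _ _} (dec _) _     = inj₂ tt
merger-LeftOK {y = dec _ _} (dec q) ¬same = contradiction q ¬same

merger-RightOK : ∀ {x y m} → Merger x y m → ¬ SameWayʳ x y → RightOK m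
merger-RightOK {x = leaf _}  (inc _) _     = inj₁ tt
merger-RightOK {x = inc _ _} (inc p) ¬same = contradiction p ¬same
merger-RightOK {x = dec _ _} (inc _) _     = inj₂ tt
merger-RightOK {x = leaf _}  (dec _) _     = inj₁ tt
merger-RightOK {x = inc _ _} (dec _) _     = inj₂ tt
merger-RightOK {x = dec _ _} (dec q) ¬same = contradiction q ¬same

unmergeable⇒¬sameWayˡ-merger : ∀ {w x y m} →
  Merger x y m → Unmergeable w x → ¬ SameWayˡ w m
unmergeable⇒¬sameWayˡ-merger {x = x} {y} (inc p) (unmergeable ¬inc _) same =
  ¬inc (trans same (lo-inc x y p))
unmergeable⇒¬sameWayˡ-merger {x = x} {y} (dec q) (unmergeable _ ¬dec) same =
  ¬dec (trans same (cong suc (hi-dec x y q)))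

unmergeable⇒¬sameWayʳ-merger : ∀ {x y m z} →
  Merger x y m → Unmergeable y z → ¬ SameWayʳ m z
unmergeable⇒¬sameWayʳ-merger {x} {y} (inc p) (unmergeable ¬inc _) same =
  ¬inc (trans (cong suc (sym (hi-inc x y p))) same)
unmergeable⇒¬sameWayʳ-merger {x} {y} (dec q) (unmergeable _ ¬dec) same =
  ¬dec (trans (sym (lo-dec x y q)) same)

stepL-∷ : ∀ x y rest {l′ m} → stepL (x ∷ y ∷ rest) ≡ just (l′ , m) →
  (Merger x y m × l′ ≡ m ∷ rest) ⊎
  (Unmergeable x y × ∃[ l″ ] stepL (y ∷ rest) ≡ just (l″ , m) × l′ ≡ x ∷ l″)
stepL-∷ x y rest eq with merge x y in e | stepL (y ∷ rest)
stepL-∷ x y rest refl | just m  | _ = inj₁ (merge≡just⇒merger x y e , refl)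
stepL-∷ x y rest refl | nothing | just (l″ , m) =
  inj₂ (merge≡nothing⇒unmergeable x y e , l″ , refl , refl)

stepR-∷ : ∀ x y rest {l′ m} → stepR (x ∷ y ∷ rest) ≡ just (l′ , m) →
  (∃[ l″ ] stepR (y ∷ rest) ≡ just (l″ , m) × l′ ≡ x ∷ l″) ⊎
  (stepR (y ∷ rest) ≡ nothing × Merger x y m × l′ ≡ m ∷ rest)
stepR-∷ x y rest eq with stepR (y ∷ rest) | merge x y in e
stepR-∷ x y rest refl | just (l″ , m) | _ = inj₁ (l″ , refl , refl)
stepR-∷ x y rest refl | nothing | just m = inj₂ (refl , merge≡just⇒merger x y e , refl)

stepR≡nothing⇒linked : ∀ x l → stepR (x ∷ l) ≡ nothing → Linked Unmergeable (x ∷ l)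
stepR≡nothing⇒linked x []       _ = [-]
stepR≡nothing⇒linked x (y ∷ rest) eq with stepR (y ∷ rest) in e′ | merge x y in e
... | nothing | nothing = merge≡nothing⇒unmergeable x y e ∷ stepR≡nothing⇒linked y rest e′

linked⇒stepR≡nothing : ∀ {l} → Linked Unmergeable l → stepR l ≡ nothing
linked⇒stepR≡nothing []  = refl
linked⇒stepR≡nothing [-] = refl
linked⇒stepR≡nothing {x ∷ y ∷ rest} (u ∷ us)
  with stepR (y ∷ rest) | linked⇒stepR≡nothing us | merge x y | unmergeable⇒merge≡nothing u
... | .nothing | refl | .nothing | refl = refl

formed-All : ∀ {P : Meld → Set} {Inv : List Meld → Set} step →
  (∀ {l l′ m} → Inv l → step l ≡ just (l′ , m) → P m × Inv l′) →
  ∀ k {l} → Inv l → All P (formed step k l)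
formed-All step preserves zero    inv = []
formed-All step preserves (suc k) {l} inv with step l in eq
... | nothing      = []
... | just (l′ , m) with preserves inv eq
...   | ok , inv′  = ok ∷ formed-All step preserves k inv′

data LeftInv : List Meld → Set where
  []       : LeftInv []
  [-]      : ∀ {x} → LeftInv (x ∷ [])
  stuck    : ∀ {x y l} → Unmergeable x y → LeftInv (y ∷ l) → LeftInv (x ∷ y ∷ l)
  frontier : ∀ {x y l} → ¬ SameWayˡ x y → All IsSingleton l → LeftInv (x ∷ y ∷ l)

LeftInv-singletons : ∀ {x l} → All IsSingleton l → LeftInv (x ∷ l)
LeftInv-singletons []                       = [-]
LeftInv-singletons {l = leaf _ ∷ _} (_ ∷ s) = frontier (λ ()) s

LeftInv-tail : ∀ {x l} → LeftInv (x ∷ l) → LeftInv l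
LeftInv-tail [-]            = []
LeftInv-tail (stuck _ inv)  = inv
LeftInv-tail (frontier _ s) = LeftInv-singletons s

stepL-LeftInv : ∀ {x l l′ m} → LeftInv (x ∷ l) → stepL (x ∷ l) ≡ just (l′ , m) →
  LeftOK m × LeftInv l′ × (∀ {w} → Unmergeable w x → LeftInv (w ∷ l′))
stepL-LeftInv {x} {y ∷ rest} inv eq with stepL-∷ x y rest eq | inv
... | inj₁ (merged , refl) | stuck u _ = contradiction u (merger⇒¬unmergeable merged)
... | inj₁ (merged , refl) | frontier ¬same s =
  merger-LeftOK merged ¬same , LeftInv-singletons s ,
  λ u → frontier (unmergeable⇒¬sameWayˡ-merger merged u) s
... | inj₂ (u , l″ , e , refl) | _ with stepL-LeftInv (LeftInv-tail inv) e
...   | ok , _ , extend = ok , extend u , λ u′ → stuck u′ (extend u)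

stepL-preserves-LeftInv : ∀ {l l′ m} →
  LeftInv l → stepL l ≡ just (l′ , m) → LeftOK m × LeftInv l′
stepL-preserves-LeftInv {_ ∷ _} inv eq with stepL-LeftInv inv eq
... | ok , inv′ , _ = ok , inv′

data RightInv : List Meld → Set where
  []        : RightInv []
  [-]       : ∀ {x} → RightInv (x ∷ [])
  singleton : ∀ {a l} → RightInv l → RightInv (leaf a ∷ l)
  frontier  : ∀ {x y l} →
    ¬ SameWayʳ x y → Linked Unmergeable (y ∷ l) → RightInv (x ∷ y ∷ l)

RightInv-singletons : ∀ {l} → All IsSingleton l → RightInv l
RightInv-singletons []                   = []
RightInv-singletons {leaf _ ∷ _} (_ ∷ s) = singleton (RightInv-singletons s)

RightInv-¬sameWayʳ : ∀ {x y l} → RightInv (x ∷ y ∷ l) → ¬ SameWayʳ x y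
RightInv-¬sameWayʳ (singleton _)      = λ ()
RightInv-¬sameWayʳ (frontier ¬same _) = ¬same

merger-RightInv : ∀ {x y m rest} →
  Merger x y m → Linked Unmergeable (y ∷ rest) → RightInv (m ∷ rest)
merger-RightInv merged [-]      = [-]
merger-RightInv merged (u ∷ us) = frontier (unmergeable⇒¬sameWayʳ-merger merged u) us

stepR-preserves-RightInv : ∀ {l l′ m} →
  RightInv l → stepR l ≡ just (l′ , m) → RightOK m × RightInv l′
stepR-preserves-RightInv {x ∷ y ∷ rest} inv eq with stepR-∷ x y rest eq | inv
... | inj₁ (_ , e , refl) | singleton inv′ =
  map₂ singleton (stepR-preserves-RightInv inv′ e)
... | inj₁ (_ , e , refl) | frontier _ us =
  contradiction (trans (sym e) (linked⇒stepR≡nothing us)) λ ()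
... | inj₂ (e , merged , refl) | _ =
  merger-RightOK merged (RightInv-¬sameWayʳ inv) ,
  merger-RightInv merged (stepR≡nothing⇒linked y rest e)

formedLeft-LeftOK : ∀ l → All IsSingleton l → All LeftOK (formedLeft l)
formedLeft-LeftOK []      _       = []
formedLeft-LeftOK (x ∷ l) (_ ∷ s) =
  formed-All stepL stepL-preserves-LeftInv (length (x ∷ l)) (LeftInv-singletons s)

formedRight-RightOK : ∀ l → All IsSingleton l → All RightOK (formedRight l)
formedRight-RightOK l s =
  formed-All stepR stepR-preserves-RightInv (length l) (RightInv-singletons s)

singletons-IsSingleton : ∀ {n} (π : Permutation′ n) → All IsSingleton (singletons π)
singletons-IsSingleton {n} π = map⁺ (universal (λ _ → tt) (allFin n))

lemma2p24 : (n : ℕ) → 1 < n → (π : Permutation′ n) →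
    All LeftOK (formedLeft (singletons π)) × All RightOK (formedRight (singletons π))
lemma2p24 n _ π = formedLeft-LeftOK _ leaves , formedRight-RightOK _ leaves
  where
  leaves : All IsSingleton (singletons π)
  leaves = singletons-IsSingleton π
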